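{- Let $w$ be a word over $\{0,1\}$ of length at least $3$ which begins with $0$ and ends with $1$, and let $(0; \ell_1, \ldots, \ell_n)$ be its alternating block decomposition. Then all $\ell_i > 1$ if and only if \[ w = 0\,1\,0^{s_1 - 1}\,1\,0^{s_2-1} \cdots 1\,0^{s_k - 1}\,1 \] for some $k \geq 1$ and positive integers $s_1, \ldots, s_k$ with $s_k \geq 2$ such that every $s_i \in \{1,2,3\}$ and there is no $i$ with $s_i = s_{i+1} = 1$. (Such $w$ is the word of the iterated integral $I(w) = (-1)^k \zeta(s_1, \ldots, s_k)$.)
   Context: For $\epsilon \in \{0,1\}$, $W_\epsilon^\ell$ is the alternating word of length $\ell$ over $\{0,1\}$ starting with $\epsilon$. Every word $w$ over $\{0,1\}$ can be written uniquely as $W_{\epsilon_1}^{\ell_1} \cdots W_{\epsilon_n}^{\ell_n}$ where the last letter of each block equals the first letter of the next; its alternating block decomposition is $(\epsilon_1; \ell_1, \ldots, \ell_n)$. $0^j$ denotes $j$ copies of the letter $0$. Multiple zeta values: $\zeta(s_1, \ldots, s_k) = \sum_{0 < n_1 < \cdots < n_k} n_1^{ -s_1}\cdots n_k^{ -s_k}$, and $\zeta(s_1,\ldots,s_k) = (-1)^k I(0; 1, 0^{s_1-1}, \ldots, 1, 0^{s_k-1}; 1)$. -}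

module Defs where

open import Data.Nat using (ℕ; zero; suc; _∸_; _≤_)
open import Data.List using (List; []; _∷_; _++_; replicate; concatMap)
open import Data.List.Relation.Unary.All using (All)
open import Data.Product using (_×_)
open import Relation.Binary.PropositionalEquality using (_≡_)

data Letter : Set where
  𝟘 𝟙 : Letter

Word : Set
Word = List Letter

flipL : Letter → Letter
flipL 𝟘 = 𝟙
flipL 𝟙 = 𝟘

W : Letter → ℕ → Word
W e zero    = []
W e (suc l) = e ∷ W (flipL e) l

-- last letter of W ε ℓ (for ℓ ≥ 1): ε flipped (ℓ - 1) times
flipN : ℕ → Letter → Letter
flipN zero    e = e
flipN (suc n) e = flipN n (flipL e)

lastW : Letter → ℕ → Letter
lastW e l = flipN (l ∸ 1) e

-- W_{ε₁}^{ℓ₁} ⋯ W_{εₙ}^{ℓₙ} where ε_{i+1} is the last letter of block i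
blocks : Letter → List ℕ → Word
blocks e []       = []
blocks e (l ∷ ls) = W e l ++ blocks (lastW e l) ls

IsABD : Word → Letter → List ℕ → Set
IsABD w e ls = All (1 ≤_) ls × blocks e ls ≡ w

zetaWord : List ℕ → Word
zetaWord ss = 𝟘 ∷ (concatMap (λ s → 𝟙 ∷ replicate (s ∸ 1) 𝟘) ss ++ 𝟙 ∷ [])

module Submission where

-- Both sides of the equivalence are regular conditions on the word w, and the
-- proof compares them through one finite automaton, 'accepts', which reads a
-- word letter by letter and rejects as soon as an alternating block of length 1
-- is completed.
--
-- Block side: run on the block decomposition blocks 𝟘 ls, the automaton
-- computes exactly the boolean test "every ℓᵢ > 1" (accepts-blocks).
--
-- Zeta side: a word 0 1 … 1 is cut into segments 1 0^{s-1} (parseSegments),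
-- i.e. it is zetaWord ss.  At every segment boundary the automaton is in one of
-- two states (after a 0, or after a lone 1), so on segments it computes a
-- boolean test on the index list ss (accepts-after0/accepts-after1), and this
-- test holds iff ss has entries in {1,2,3}, no two consecutive 1s and last
-- entry ≥ 2 (admissibleAfter⇔).

open import Defs
open import Data.Nat using (ℕ; _≤_; _<_)
open import Data.List using (List; []; _∷_; _++_; length; head; last)
open import Data.List.Relation.Unary.All using (All)
open import Data.List.Relation.Unary.Linked using (Linked)
open import Data.Maybe using (just)
open import Data.Product using (_×_; ∃-syntax)
open import Data.Sum using (_⊎_)
open import Function.Bundles using (_⇔_)
open import Relation.Binary.PropositionalEquality using (_≡_)
open import Relation.Nullary using (¬_)

open import Data.Bool using (Bool; true; false; not; _∧_; T)
open import Data.Nat using (zero; suc; _∸_; z≤n; s≤s; _<ᵇ_)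
open import Data.Nat.Properties using (<ᵇ⇒<; <⇒<ᵇ; <⇒≢)
open import Data.List using (replicate; concatMap)
open import Data.Bool.ListAction using (all)
open import Data.List.Properties using (++-assoc)
open import Data.List.Relation.Unary.All using ([]; _∷_)
import Data.List.Relation.Unary.All as All
open import Data.List.Relation.Unary.All.Properties using (all⁺; all⁻)
open import Data.List.Relation.Unary.Linked using ([]; [-]; _∷_)
import Data.List.Relation.Unary.Linked as Linked
open import Data.Product using (_,_)
open import Data.Sum using (inj₁; inj₂)
open import Data.Unit using (⊤; tt)
open import Function.Bundles using (mk⇔; Equivalence)
open import Relation.Binary.PropositionalEquality using (refl; sym; trans; cong; subst)

-- accepts p short xs reads xs after the letter p; 'short' says that the block
-- being read so far consists of p alone.  A repeated letter closes the current
-- block (rejecting if it is short) and opens a new short one; at the end of the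
-- word the last block must not be short.  A word beginning with e is read from
-- the state (e, false), so that its first letter opens the first block.
accepts : Letter → Bool → Word → Bool
accepts p short []       = not short
accepts 𝟘 short (𝟙 ∷ xs) = accepts 𝟙 false xs
accepts 𝟙 short (𝟘 ∷ xs) = accepts 𝟘 false xs
accepts 𝟘 true  (𝟘 ∷ xs) = false
accepts 𝟙 true  (𝟙 ∷ xs) = false
accepts 𝟘 false (𝟘 ∷ xs) = accepts 𝟘 true xs
accepts 𝟙 false (𝟙 ∷ xs) = accepts 𝟙 true xs

accepts-W : ∀ p k short X →
  accepts p short (W (flipL p) (suc k) ++ X) ≡ accepts (flipN (suc k) p) false X
accepts-W 𝟘 zero    short X = refl
accepts-W 𝟙 zero    short X = refl
accepts-W 𝟘 (suc k) short X = accepts-W 𝟙 k false X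
accepts-W 𝟙 (suc k) short X = accepts-W 𝟘 k false X

accepts-blocks : ∀ e ls → All (1 ≤_) ls → accepts e false (blocks e ls) ≡ all (1 <ᵇ_) ls
accepts-blocks 𝟘 []                     _            = refl
accepts-blocks 𝟙 []                     _            = refl
accepts-blocks e (zero ∷ ls)            (() ∷ _)
accepts-blocks 𝟘 (1 ∷ [])               _            = refl
accepts-blocks 𝟙 (1 ∷ [])               _            = refl
accepts-blocks e (1 ∷ zero ∷ ls)        (_ ∷ () ∷ _)
accepts-blocks 𝟘 (1 ∷ suc m ∷ ls)       _            = refl
accepts-blocks 𝟙 (1 ∷ suc m ∷ ls)       _            = refl
accepts-blocks 𝟘 (suc (suc k) ∷ ls)     (_ ∷ pos)    =
  trans (accepts-W 𝟘 k true _) (accepts-blocks (flipN (suc k) 𝟘) ls pos)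
accepts-blocks 𝟙 (suc (suc k) ∷ ls)     (_ ∷ pos)    =
  trans (accepts-W 𝟙 k true _) (accepts-blocks (flipN (suc k) 𝟙) ls pos)

all-long⇔ : ∀ ls → T (all (1 <ᵇ_) ls) ⇔ All (1 <_) ls
all-long⇔ ls = mk⇔
  (λ t → All.map (λ {l} → <ᵇ⇒< 1 l) (all⁺ (1 <ᵇ_) ls t))
  (λ long → all⁻ (1 <ᵇ_) (All.map <⇒<ᵇ long))

accepts⇔noShortBlock : ∀ {w e ls} → IsABD w e ls → T (accepts e false w) ⇔ All (1 <_) ls
accepts⇔noShortBlock {e = e} {ls} (pos , refl) =
  subst (λ b → T b ⇔ All (1 <_) ls) (sym (accepts-blocks e ls pos)) (all-long⇔ ls)

segment : ℕ → Word
segment s = 𝟙 ∷ replicate (s ∸ 1) 𝟘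

segments : List ℕ → Word
segments []       = 𝟙 ∷ []
segments (s ∷ ss) = segment s ++ segments ss

zetaWord-segments : ∀ ss → zetaWord ss ≡ 𝟘 ∷ segments ss
zetaWord-segments ss = cong (𝟘 ∷_) (concat-segments ss)
  where
  concat-segments : ∀ ss → concatMap segment ss ++ 𝟙 ∷ [] ≡ segments ss
  concat-segments []       = refl
  concat-segments (s ∷ ss) =
    trans (++-assoc (segment s) _ (𝟙 ∷ [])) (cong (segment s ++_) (concat-segments ss))

replicate-++-∷ : ∀ c (x : Letter) ys → replicate c x ++ x ∷ ys ≡ x ∷ replicate c x ++ ys
replicate-++-∷ zero    x ys = refl
replicate-++-∷ (suc c) x ys = cong (x ∷_) (replicate-++-∷ c x ys)

parseSegments : ∀ c ys → last ys ≡ just 𝟙 →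
  ∃[ s ] ∃[ ss ] All (1 ≤_) (s ∷ ss) × 𝟙 ∷ replicate c 𝟘 ++ ys ≡ segments (s ∷ ss)
parseSegments c (𝟘 ∷ [])     ()
parseSegments c (𝟘 ∷ y ∷ ys) end with parseSegments (suc c) (y ∷ ys) end
... | s , ss , pos , eq = s , ss , pos , trans (cong (𝟙 ∷_) (replicate-++-∷ c 𝟘 (y ∷ ys))) eq
parseSegments c (𝟙 ∷ [])     _   = suc c , [] , s≤s z≤n ∷ [] , refl
parseSegments c (𝟙 ∷ y ∷ ys) end with parseSegments 0 (y ∷ ys) end
... | s , ss , pos , eq = suc c , s ∷ ss , s≤s z≤n ∷ pos , cong (λ v → 𝟙 ∷ replicate c 𝟘 ++ v) eq

Digit : ℕ → Set
Digit s = s ≡ 1 ⊎ s ≡ 2 ⊎ s ≡ 3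

NotBothOne : ℕ → ℕ → Set
NotBothOne a b = ¬ (a ≡ 1 × b ≡ 1)

EndsAtLeast2 : List ℕ → Set
EndsAtLeast2 []           = ⊤
EndsAtLeast2 (s ∷ [])     = 2 ≤ s
EndsAtLeast2 (_ ∷ t ∷ ts) = EndsAtLeast2 (t ∷ ts)

Admissible : List ℕ → Set
Admissible ss = All Digit ss × Linked NotBothOne ss × EndsAtLeast2 ss

prefixOne : Bool → List ℕ → List ℕ
prefixOne true  ss = 1 ∷ ss
prefixOne false ss = ss

-- The boolean test for Admissible (prefixOne one ss), read left to right.
admissibleAfter : Bool → List ℕ → Bool
admissibleAfter one []                            = not one
admissibleAfter one (1 ∷ ss)                      = not one ∧ admissibleAfter true ss
admissibleAfter one (2 ∷ ss)                      = admissibleAfter false ss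
admissibleAfter one (3 ∷ ss)                      = admissibleAfter false ss
admissibleAfter one (0 ∷ ss)                      = false
admissibleAfter one (suc (suc (suc (suc _))) ∷ _) = false

prepend-large : ∀ {s ss} → Digit s → 2 ≤ s → Admissible ss → Admissible (s ∷ ss)
prepend-large {ss = []}    d two _             = d ∷ [] , [-] , two
prepend-large {ss = _ ∷ _} d two (ds , l , end) =
  d ∷ ds , (λ (s≡1 , _) → <⇒≢ two (sym s≡1)) ∷ l , end

prepend-one : ∀ {t ts} → ¬ t ≡ 1 → Admissible (t ∷ ts) → Admissible (1 ∷ t ∷ ts)
prepend-one t≢1 (ds , l , end) = inj₁ refl ∷ ds , (λ (_ , t≡1) → t≢1 t≡1) ∷ l , end

admissible-tail : ∀ {s ss} → Admissible (s ∷ ss) → Admissible ss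
admissible-tail {ss = []}    _                   = [] , [] , tt
admissible-tail {ss = _ ∷ _} (_ ∷ ds , l , end) = ds , Linked.tail l , end

admissibleAfter-sound : ∀ one ss → T (admissibleAfter one ss) → Admissible (prefixOne one ss)
admissibleAfter-sound false []       _ = [] , [] , tt
admissibleAfter-sound true  []       ()
admissibleAfter-sound false (1 ∷ ss) t = admissibleAfter-sound true ss t
admissibleAfter-sound true  (1 ∷ ss) ()
admissibleAfter-sound false (2 ∷ ss) t =
  prepend-large (inj₂ (inj₁ refl)) (s≤s (s≤s z≤n)) (admissibleAfter-sound false ss t)
admissibleAfter-sound true  (2 ∷ ss) t = prepend-one (λ ())
  (prepend-large (inj₂ (inj₁ refl)) (s≤s (s≤s z≤n)) (admissibleAfter-sound false ss t))
admissibleAfter-sound false (3 ∷ ss) t =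
  prepend-large (inj₂ (inj₂ refl)) (s≤s (s≤s z≤n)) (admissibleAfter-sound false ss t)
admissibleAfter-sound true  (3 ∷ ss) t = prepend-one (λ ())
  (prepend-large (inj₂ (inj₂ refl)) (s≤s (s≤s z≤n)) (admissibleAfter-sound false ss t))
admissibleAfter-sound one   (0 ∷ ss) ()
admissibleAfter-sound one   (suc (suc (suc (suc _))) ∷ _) ()

-- A 1 after a 1 violates NotBothOne, and a trailing 1 violates EndsAtLeast2.
admissibleAfter-complete : ∀ one ss → Admissible (prefixOne one ss) → T (admissibleAfter one ss)
admissibleAfter-complete false [] _ = tt
admissibleAfter-complete true  [] (_ , _ , s≤s ())
admissibleAfter-complete false (.1 ∷ ss) adm@(inj₁ refl ∷ _ , _) =
  admissibleAfter-complete true ss adm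
admissibleAfter-complete false (.2 ∷ ss) adm@(inj₂ (inj₁ refl) ∷ _ , _) =
  admissibleAfter-complete false ss (admissible-tail adm)
admissibleAfter-complete false (.3 ∷ ss) adm@(inj₂ (inj₂ refl) ∷ _ , _) =
  admissibleAfter-complete false ss (admissible-tail adm)
admissibleAfter-complete true (.1 ∷ ss) (_ ∷ inj₁ refl ∷ _ , ones ∷ _ , _) = ones (refl , refl)
admissibleAfter-complete true (.2 ∷ ss) adm@(_ ∷ inj₂ (inj₁ refl) ∷ _ , _) =
  admissibleAfter-complete false ss (admissible-tail (admissible-tail adm))
admissibleAfter-complete true (.3 ∷ ss) adm@(_ ∷ inj₂ (inj₂ refl) ∷ _ , _) =
  admissibleAfter-complete false ss (admissible-tail (admissible-tail adm))

admissibleAfter⇔ : ∀ one ss → T (admissibleAfter one ss) ⇔ Admissible (prefixOne one ss)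
admissibleAfter⇔ one ss = mk⇔ (admissibleAfter-sound one ss) (admissibleAfter-complete one ss)

-- At a segment boundary the automaton is either after a 0 (the previous index
-- was 2 or 3, or we are after the leading 0) or after a lone 1 (the previous
-- index was 1); from there it runs the admissibility test on the remaining
-- indices.
accepts-after0 : ∀ short ss → All (1 ≤_) ss → accepts 𝟘 short (segments ss) ≡ admissibleAfter false ss
accepts-after1 : ∀ ss → All (1 ≤_) ss → accepts 𝟙 false (segments ss) ≡ admissibleAfter true ss

accepts-after0 short []                            _         = refl
accepts-after0 short (0 ∷ _)                       (() ∷ _)
accepts-after0 short (1 ∷ ss)                      (_ ∷ pos) = accepts-after1 ss pos
accepts-after0 short (2 ∷ ss)                      (_ ∷ pos) = accepts-after0 false ss pos
accepts-after0 short (3 ∷ ss)                      (_ ∷ pos) = accepts-after0 true ss pos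
accepts-after0 short (suc (suc (suc (suc _))) ∷ _) _         = refl

accepts-after1 []                            _         = refl
accepts-after1 (0 ∷ _)                       (() ∷ _)
accepts-after1 (1 ∷ [])                      _         = refl
accepts-after1 (1 ∷ _ ∷ _)                   _         = refl
accepts-after1 (2 ∷ ss)                      (_ ∷ pos) = accepts-after0 false ss pos
accepts-after1 (3 ∷ ss)                      (_ ∷ pos) = accepts-after0 true ss pos
accepts-after1 (suc (suc (suc (suc _))) ∷ _) _         = refl

accepts-zetaWord : ∀ ss → All (1 ≤_) ss → T (accepts 𝟘 false (zetaWord ss)) ⇔ Admissible ss
accepts-zetaWord ss pos =
  subst (λ b → T b ⇔ Admissible ss) (sym accepts≡) (admissibleAfter⇔ false ss)
  where
  -- the leading 0 opens the first block, then the segments are read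
  accepts≡ : accepts 𝟘 false (zetaWord ss) ≡ admissibleAfter false ss
  accepts≡ = trans (cong (accepts 𝟘 false) (zetaWord-segments ss)) (accepts-after0 true ss pos)

ZetaForm : Word → Set
ZetaForm w = ∃[ ss ] ∃[ ss′ ] ∃[ sk ]
  (ss ≡ ss′ ++ sk ∷ []) × 2 ≤ sk × All Digit ss × Linked NotBothOne ss × w ≡ zetaWord ss

endsAtLeast2→snoc : ∀ s ss → EndsAtLeast2 (s ∷ ss) →
  ∃[ ss′ ] ∃[ sk ] (s ∷ ss ≡ ss′ ++ sk ∷ []) × 2 ≤ sk
endsAtLeast2→snoc s []       two = [] , s , refl , two
endsAtLeast2→snoc s (t ∷ ts) end with endsAtLeast2→snoc t ts end
... | ss′ , sk , eq , two = s ∷ ss′ , sk , cong (s ∷_) eq , two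

snoc→endsAtLeast2 : ∀ ss′ {sk} → 2 ≤ sk → EndsAtLeast2 (ss′ ++ sk ∷ [])
snoc→endsAtLeast2 []           two = two
snoc→endsAtLeast2 (_ ∷ [])     two = two
snoc→endsAtLeast2 (_ ∷ t ∷ ts) two = snoc→endsAtLeast2 (t ∷ ts) two

digit-positive : ∀ {s} → Digit s → 1 ≤ s
digit-positive (inj₁ refl)        = s≤s z≤n
digit-positive (inj₂ (inj₁ refl)) = s≤s z≤n
digit-positive (inj₂ (inj₂ refl)) = s≤s z≤n

zetaForm→accepted : ∀ w → ZetaForm w → T (accepts 𝟘 false w)
zetaForm→accepted w (ss , ss′ , sk , refl , two , ds , l , refl) =
  Equivalence.from (accepts-zetaWord ss (All.map digit-positive ds))
    (ds , l , snoc→endsAtLeast2 ss′ two)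

admissible→zetaForm : ∀ {w} s ss → w ≡ zetaWord (s ∷ ss) → Admissible (s ∷ ss) → ZetaForm w
admissible→zetaForm s ss w≡ (ds , l , end) with endsAtLeast2→snoc s ss end
... | ss′ , sk , snoc , two = s ∷ ss , ss′ , sk , snoc , two , ds , l , w≡

-- An accepted word 0 … 1 of length ≥ 3 starts with 01 (a leading 00 would be a
-- block of length 1), so it parses into segments, and acceptance makes the index list
-- admissible.
accepted→zetaForm : ∀ w → 3 ≤ length w → head w ≡ just 𝟘 → last w ≡ just 𝟙 →
  T (accepts 𝟘 false w) → ZetaForm w
accepted→zetaForm []               ()                   _  _   _
accepted→zetaForm (𝟙 ∷ _)          _                    () _   _
accepted→zetaForm (𝟘 ∷ 𝟘 ∷ _)      _                    _  _   ()
accepted→zetaForm (𝟘 ∷ [])         (s≤s ())             _  _   _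
accepted→zetaForm (𝟘 ∷ 𝟙 ∷ [])     (s≤s (s≤s ()))       _  _   _
accepted→zetaForm (𝟘 ∷ 𝟙 ∷ y ∷ ys) _                    _  end t
  with parseSegments 0 (y ∷ ys) end
... | s , ss , pos , eq =
  admissible→zetaForm s ss w≡
    (Equivalence.to (accepts-zetaWord (s ∷ ss) pos) (subst (λ v → T (accepts 𝟘 false v)) w≡ t))
  where
  w≡ : 𝟘 ∷ 𝟙 ∷ y ∷ ys ≡ zetaWord (s ∷ ss)
  w≡ = trans (cong (𝟘 ∷_) eq) (sym (zetaWord-segments (s ∷ ss)))

proposition7p2 : (w : Word) → 3 ≤ length w → head w ≡ just 𝟘 → last w ≡ just 𝟙 →
    (ls : List ℕ) → IsABD w 𝟘 ls →
    (All (1 <_) ls ⇔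
      (∃[ ss ] ∃[ ss′ ] ∃[ sk ]
        (ss ≡ ss′ ++ sk ∷ [])
        × 2 ≤ sk
        × All (λ s → s ≡ 1 ⊎ s ≡ 2 ⊎ s ≡ 3) ss
        × Linked (λ a b → ¬ (a ≡ 1 × b ≡ 1)) ss
        × w ≡ zetaWord ss))
proposition7p2 w len hd lst ls abd = mk⇔
  (λ long → accepted→zetaForm w len hd lst (Equivalence.from noShortBlock long))
  (λ zeta → Equivalence.to noShortBlock (zetaForm→accepted w zeta))
  where
  noShortBlock : T (accepts 𝟘 false w) ⇔ All (1 <_) ls
  noShortBlock = accepts⇔noShortBlock abd
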